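{- Let $(B_t)_{t\in\mathbb{T}_n}$ be an exchange matrix pattern of totally sign-skew-symmetric $n\times n$ matrices and let $t_0\in\mathbb{T}_n$. For each edge $t\overset{k}{\text{ --- }}t'$ of $\mathbb{T}_n$, \[C^{t_0}_{t'}=C^{t_0}_t\bigl(J_k+[\varepsilon B_t]_+^{k\cdot}\bigr),\qquad G^{t_0}_{t'}=G^{t_0}_t\bigl(J_k+[-\varepsilon B_t]_+^{\cdot k}\bigr),\] where $\varepsilon=\varepsilon_k(C^{t_0}_t)$.
   Context: For real $a$, $[a]_+=\max(a,0)$. An integer $n\times n$ matrix $B=(b_{ij})$ is sign-skew-symmetric if $b_{ij}b_{ji}\le0$ for all $i,j$ and $b_{ij}b_{ji}=0$ implies $b_{ij}=b_{ji}=0$. Its mutation at $k\in\{1,\dots,n\}$ is $\mu_k(B)=(b'_{ij})$ with $b'_{ij}=-b_{ij}$ if $i=k$ or $j=k$, and $b'_{ij}=b_{ij}+\mathrm{sign}(b_{ik})[b_{ik}b_{kj}]_+$ otherwise. $B$ is totally sign-skew-symmetric if every matrix obtained from $B$ by finitely many mutations is sign-skew-symmetric. $\mathbb{T}_n$ is the $n$-regular tree whose edges are labeled by $1,\dots,n$ so that the $n$ edges at each vertex carry distinct labels; $t\overset{k}{\text{ --- }}t'$ denotes an edge labeled $k$. An exchange matrix pattern assigns to each $t\in\mathbb{T}_n$ a totally sign-skew-symmetric matrix $B_t$ with $B_{t'}=\mu_k(B_t)$ whenever $t\overset{k}{\text{ --- }}t'$. For an $n\times n$ matrix $A$: $[A]_+$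 is obtained by replacing each entry by its positive part; $A^{k\cdot}$ is obtained by replacing all entries outside the $k$-th row by $0$; $A^{\cdot k}$ by replacing all entries outside the $k$-th column by $0$; $J_k$ is the identity matrix with its $(k,k)$ entry replaced by $-1$. For an initial vertex $t_0$, the $C$-matrices $C^{t_0}_t$ and $G$-matrices $G^{t_0}_t$ ($t\in\mathbb{T}_n$) are defined by $C^{t_0}_{t_0}=G^{t_0}_{t_0}=I_n$ and, recursively along the path from $t_0$, for each edge $t\overset{k}{\text{ --- }}t'$ with $t$ closer to $t_0$: $C^{t_0}_{t'}=C^{t_0}_t(J_k+[B_t]_+^{k\cdot})+[-C^{t_0}_t]_+^{\cdot k}B_t$ and $G^{t_0}_{t'}=G^{t_0}_t(J_k+[-B_t]_+^{\cdot k})-B_{t_0}[-C^{t_0}_t]_+^{\cdot k}$; equivalently, the columns of $C^{t_0}_t$ (c-vectors) and $G^{t_0}_t$ (g-vectors) are the c-vectors and g-vectors at $t$ of the cluster algebra with principal coefficients and initial exchange matrix $B_{t_0}$ at $t_0$. It is known that every column of every $C$-matrix is nonzero and sign-coherent (all entries $\ge0$ or all $\le0$); $\varepsilon_k(C)\in\{1,-1\}$ denotes the sign of the $k$-th column of $C$. -}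

module Defs where

open import Data.Nat using (ℕ; zero; suc)
open import Data.Integer using (ℤ; +_; -[1+_]; _+_; _*_; -_; _-_; _≤_; _⊔_; 0ℤ; 1ℤ; -1ℤ)
open import Data.Fin using (Fin; _≟_) renaming (zero to fzero; suc to fsuc)
open import Data.List using (List; []; _∷_; _++_; reverse; foldl)
open import Data.Bool using (Bool; true; false; _∧_; not; T)
open import Data.Product using (Σ; _,_; _×_; proj₁; proj₂)
open import Data.Empty using (⊥-elim)
open import Data.Sum using (_⊎_)
open import Relation.Nullary using (yes; no; does; ¬_)
open import Relation.Binary.PropositionalEquality using (_≡_)

Matrix : ℕ → Set
Matrix n = Fin n → Fin n → ℤ

_≈ᴹ_ : ∀ {n} → Matrix n → Matrix n → Set
A ≈ᴹ B = ∀ i j → A i j ≡ B i j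

sumFin : ∀ {n} → (Fin n → ℤ) → ℤ
sumFin {zero}  f = 0ℤ
sumFin {suc n} f = f fzero + sumFin (λ i → f (fsuc i))

_⊕_ : ∀ {n} → Matrix n → Matrix n → Matrix n
(A ⊕ B) i j = A i j + B i j

_⊖_ : ∀ {n} → Matrix n → Matrix n → Matrix n
(A ⊖ B) i j = A i j - B i j

_⊗_ : ∀ {n} → Matrix n → Matrix n → Matrix n
(A ⊗ B) i j = sumFin (λ l → A i l * B l j)

negᴹ : ∀ {n} → Matrix n → Matrix n
negᴹ A i j = - A i j

scaleᴹ : ∀ {n} → ℤ → Matrix n → Matrix n
scaleᴹ c A i j = c * A i j

pos : ℤ → ℤ
pos a = a ⊔ 0ℤ

posᴹ : ∀ {n} → Matrix n → Matrix n
posᴹ A i j = pos (A i j)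

sgn : ℤ → ℤ
sgn (+ zero)    = 0ℤ
sgn (+ suc _)   = 1ℤ
sgn -[1+ _ ]    = -1ℤ

-- A^{k·}: keep only the k-th row
rowOnly : ∀ {n} → Fin n → Matrix n → Matrix n
rowOnly k A i j with does (i ≟ k)
... | true  = A i j
... | false = 0ℤ

-- A^{·k}: keep only the k-th column
colOnly : ∀ {n} → Fin n → Matrix n → Matrix n
colOnly k A i j with does (j ≟ k)
... | true  = A i j
... | false = 0ℤ

Iᴹ : ∀ {n} → Matrix n
Iᴹ i j with does (i ≟ j)
... | true  = 1ℤ
... | false = 0ℤ

J : ∀ {n} → Fin n → Matrix n
J k i j with does (i ≟ j) | does (i ≟ k)
... | true  | true  = -1ℤ
... | true  | false = 1ℤ
... | false | _     = 0ℤ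

μ : ∀ {n} → Fin n → Matrix n → Matrix n
μ k B i j with does (i ≟ k) | does (j ≟ k)
... | false | false = B i j + sgn (B i k) * pos (B i k * B k j)
... | _     | _     = - B i j

SignSkewSymmetric : ∀ {n} → Matrix n → Set
SignSkewSymmetric B =
  ∀ i j → (B i j * B j i ≤ 0ℤ) × (B i j * B j i ≡ 0ℤ → (B i j ≡ 0ℤ) × (B j i ≡ 0ℤ))

TotallySignSkewSymmetric : ∀ {n} → Matrix n → Set
TotallySignSkewSymmetric B =
  ∀ (ks : List (Fin _)) → SignSkewSymmetric (foldl (λ A k → μ k A) B ks)

-- The n-regular tree 𝕋ₙ: reduced words in the labels 1..n (no two
-- consecutive equal letters), the most recently added letter at the head.

reducedᵇ : ∀ {n} → List (Fin n) → Bool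
reducedᵇ []           = true
reducedᵇ (_ ∷ [])     = true
reducedᵇ (k ∷ j ∷ w)  = not (does (k ≟ j)) ∧ reducedᵇ (j ∷ w)

Vertex : ℕ → Set
Vertex n = Σ (List (Fin n)) (λ w → T (reducedᵇ w))

private
  tailRed : ∀ {n} (j : Fin n) (w : List (Fin n)) → T (reducedᵇ (j ∷ w)) → T (reducedᵇ w)
  tailRed j []          r = r
  tailRed j (i ∷ w) r = T∧ʳ (not (does (j ≟ i))) r
    where
    T∧ʳ : ∀ a {b} → T (a ∧ b) → T b
    T∧ʳ true  r' = r'
    T∧ʳ false ()

step : ∀ {n} → Fin n → Vertex n → Vertex n
step k ([] , r) = (k ∷ [] , _)
step k (j ∷ w , r) with k ≟ j
... | yes _ = (w , tailRed j w r)
... | no k≢j = (k ∷ j ∷ w , consRed k≢j r)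
  where
  consRed : ¬ (k ≡ j) → T (reducedᵇ (j ∷ w)) → T (reducedᵇ (k ∷ j ∷ w))
  consRed ne r' with k ≟ j
  ... | yes e = ⊥-elim (ne e)
  ... | no _  = r'

Edge : ∀ {n} → Fin n → Vertex n → Vertex n → Set
Edge k t t' = t' ≡ step k t

IsExchangeMatrixPattern : ∀ {n} → (Vertex n → Matrix n) → Set
IsExchangeMatrixPattern {n} B =
  (∀ t → TotallySignSkewSymmetric (B t)) ×
  (∀ (k : Fin n) t t' → Edge k t t' → B t' ≈ᴹ μ k (B t))

-- Geodesic path (sequence of edge labels) from t₀ to t in 𝕋ₙ

dropCommon : ∀ {n} → List (Fin n) → List (Fin n) → List (Fin n) × List (Fin n)
dropCommon (x ∷ xs) (y ∷ ys) with does (x ≟ y)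
... | true  = dropCommon xs ys
... | false = (x ∷ xs , y ∷ ys)
dropCommon xs ys = (xs , ys)

pathLabels : ∀ {n} → Vertex n → Vertex n → List (Fin n)
pathLabels (u , _) (w , _) with dropCommon (reverse u) (reverse w)
... | (a , b) = reverse a ++ b

-- one step of the recursion along an edge t —k— t' (t closer to t₀)
CGstep : ∀ {n} → Matrix n → Matrix n → Fin n → Matrix n × Matrix n → Matrix n × Matrix n
CGstep B₀ Bt k (C , G) =
  ( (C ⊗ (J k ⊕ rowOnly k (posᴹ Bt))) ⊕ (colOnly k (posᴹ (negᴹ C)) ⊗ Bt)
  , (G ⊗ (J k ⊕ colOnly k (posᴹ (negᴹ Bt)))) ⊖ (B₀ ⊗ colOnly k (posᴹ (negᴹ C))) )

CGalong : ∀ {n} → (Vertex n → Matrix n) → Matrix n → Vertex n → List (Fin n)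
        → Matrix n × Matrix n → Matrix n × Matrix n
CGalong B B₀ v []       cg = cg
CGalong B B₀ v (k ∷ ks) cg = CGalong B B₀ (step k v) ks (CGstep B₀ (B v) k cg)

CG : ∀ {n} → (Vertex n → Matrix n) → Vertex n → Vertex n → Matrix n × Matrix n
CG B t₀ t = CGalong B (B t₀) t₀ (pathLabels t₀ t) (Iᴹ , Iᴹ)

Cmat : ∀ {n} → (Vertex n → Matrix n) → Vertex n → Vertex n → Matrix n
Cmat B t₀ t = proj₁ (CG B t₀ t)

Gmat : ∀ {n} → (Vertex n → Matrix n) → Vertex n → Vertex n → Matrix n
Gmat B t₀ t = proj₂ (CG B t₀ t)

IsColumnSign : ∀ {n} → Matrix n → Fin n → ℤ → Set
IsColumnSign C k ε =
  ((ε ≡ 1ℤ) ⊎ (ε ≡ -1ℤ)) ×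
  (Σ _ (λ i → ¬ (C i k ≡ 0ℤ))) ×
  (∀ i → 0ℤ ≤ ε * C i k)

-- Along an edge t —k— t' pointing away from t₀ the recursion for C and G differs from the stated
-- products only by terms in [-C]_+^{·k}.  If the k-th column of C has sign ε, this matrix is 0
-- (ε = 1) or -C^{·k} (ε = -1); in the latter case the duality G_t B_t = B_{t₀} C_t, which the
-- recursion preserves because (J_k + [-B]_+^{·k}) μ_k(B) = B (J_k + [B]_+^{k·}), absorbs the
-- correction terms into the products.  Along an edge pointing towards t₀ the recursion runs from t'
-- to t, the k-th column of C changes sign, and the formula at t' with sign -ε is inverted:
-- J_k + X^{k·} and J_k + Y^{·k} are involutions when X_kk = Y_kk = 0, and B_t, B_{t'} have opposite
-- k-th rows and columns.

module Submission where

open import Defs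
open import Data.Nat using (zero; suc; z≤n)
open import Data.Integer using (ℤ; +0; +[1+_]; -[1+_]; _+_; _*_; -_; _-_; _≤_; _⊔_; 0ℤ; 1ℤ; -1ℤ; +≤+; nonNegative)
open import Data.Integer.Properties hiding (_≟_)
open import Data.Integer.Tactic.RingSolver using (solve-∀)
open import Algebra.Properties.Semiring.Sum +-*-semiring
  using (sum; sum-cong-≗; ∑-distrib-+; ∑-comm; *-distribˡ-sum; *-distribʳ-sum; sum-replicate-zero)
open import Data.Fin using (Fin; _≟_) renaming (zero to fzero; suc to fsuc)
open import Data.Fin.Properties using (suc-injective)
open import Data.Bool using (T)
open import Data.Bool.Properties using (T-irrelevant; T-∧)
open import Function.Bundles using (Equivalence)
open import Data.Empty using (⊥-elim)
open import Data.Product using (_×_; _,_; proj₁; proj₂)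
open import Data.Sum using (_⊎_; inj₁; inj₂; swap)
open import Relation.Nullary using (Dec; yes; no; ¬_)
open import Relation.Nullary.Decidable using (dec-true; dec-false)
open import Relation.Binary.PropositionalEquality hiding (J)
open import Function using (_∘_)
open import Data.List using (List; []; _∷_; _++_; _∷ʳ_; reverse)
open import Data.List.Properties using (++-assoc; ++-identityʳ; unfold-reverse; reverse-involutive)
open ≡-Reasoning

pos-nonneg : ∀ {a} → 0ℤ ≤ a → pos a ≡ a
pos-nonneg = i≥j⇒i⊔j≡i

pos-nonpos : ∀ {a} → a ≤ 0ℤ → pos a ≡ 0ℤ
pos-nonpos = i≤j⇒i⊔j≡j

pos≡pos-neg+ : ∀ a → pos a ≡ pos (- a) + a
pos≡pos-neg+ +0       = refl
pos≡pos-neg+ +[1+ _ ] = refl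
pos≡pos-neg+ -[1+ n ] = sym (+-inverseʳ +[1+ n ])

pos-*-nonneg : ∀ a b → 0ℤ ≤ a → pos (a * b) ≡ a * pos b
pos-*-nonneg a b 0≤a = begin
  pos (a * b)         ≡⟨ cong (λ x → (a * b) ⊔ x) (sym (*-zeroʳ a)) ⟩
  (a * b) ⊔ (a * 0ℤ)  ≡⟨ sym (*-distribˡ-⊔-nonNeg a b 0ℤ {{nonNegative 0≤a}}) ⟩
  a * pos b           ∎

-a*b≡a*-b : ∀ a b → - a * b ≡ a * - b
-a*b≡a*-b a b = trans (sym (neg-distribˡ-* a b)) (neg-distribʳ-* a b)

sgn*pos-* : ∀ a b → sgn a * pos (a * b) ≡ a * pos b + pos (- a) * b
sgn*pos-* +0       b = refl
sgn*pos-* +[1+ m ] b = begin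
  1ℤ * pos (+[1+ m ] * b)  ≡⟨ *-identityˡ _ ⟩
  pos (+[1+ m ] * b)       ≡⟨ pos-*-nonneg +[1+ m ] b (+≤+ z≤n) ⟩
  +[1+ m ] * pos b         ≡⟨ sym (+-identityʳ _) ⟩
  +[1+ m ] * pos b + 0ℤ    ∎
sgn*pos-* -[1+ m ] b = begin
  -1ℤ * pos (- p * b)           ≡⟨ -1*i≡-i _ ⟩
  - pos (- p * b)               ≡⟨ cong (λ x → - pos x) (-a*b≡a*-b p b) ⟩
  - pos (p * - b)               ≡⟨ cong -_ (pos-*-nonneg p (- b) (+≤+ z≤n)) ⟩
  - (p * pos (- b))             ≡⟨ expand p (pos (- b)) b ⟩
  - p * (pos (- b) + b) + p * b ≡⟨ cong (λ x → - p * x + p * b) (sym (pos≡pos-neg+ b)) ⟩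
  - p * pos b + p * b           ∎
  where
  p = +[1+ m ]
  expand : ∀ p x b → - (p * x) ≡ - p * (x + b) + p * b
  expand = solve-∀

sumFin≡sum : ∀ {n} (f : Fin n → ℤ) → sumFin f ≡ sum f
sumFin≡sum {zero}  f = refl
sumFin≡sum {suc n} f = cong (λ x → f fzero + x) (sumFin≡sum (λ i → f (fsuc i)))

sum-δ : ∀ {n} (f : Fin n → ℤ) m → (∀ l → ¬ l ≡ m → f l ≡ 0ℤ) → sum f ≡ f m
sum-δ {suc n} f fzero    f≡0 = begin
  f fzero + sum (λ l → f (fsuc l))  ≡⟨ cong (λ x → f fzero + x) (sum-cong-≗ (λ l → f≡0 (fsuc l) λ ())) ⟩
  f fzero + sum {n} (λ _ → 0ℤ)      ≡⟨ cong (λ x → f fzero + x) (sum-replicate-zero n) ⟩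
  f fzero + 0ℤ                      ≡⟨ +-identityʳ _ ⟩
  f fzero                           ∎
sum-δ {suc n} f (fsuc m) f≡0 = begin
  f fzero + sum (λ l → f (fsuc l))  ≡⟨ cong (_+ sum (λ l → f (fsuc l))) (f≡0 fzero λ ()) ⟩
  0ℤ + sum (λ l → f (fsuc l))       ≡⟨ +-identityˡ _ ⟩
  sum (λ l → f (fsuc l))            ≡⟨ sum-δ (λ l → f (fsuc l)) m (λ l l≢m → f≡0 (fsuc l) (l≢m ∘ suc-injective)) ⟩
  f (fsuc m)                        ∎

sum-neg : ∀ {n} (f : Fin n → ℤ) → sum (λ l → - f l) ≡ - sum f
sum-neg f = begin
  sum (λ l → - f l)      ≡⟨ sum-cong-≗ (λ l → sym (-1*i≡-i (f l))) ⟩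
  sum (λ l → -1ℤ * f l)  ≡⟨ sym (*-distribˡ-sum -1ℤ f) ⟩
  -1ℤ * sum f            ≡⟨ -1*i≡-i _ ⟩
  - sum f                ∎

≈ᴹ-refl : ∀ {n} {A : Matrix n} → A ≈ᴹ A
≈ᴹ-refl i j = refl

≈ᴹ-sym : ∀ {n} {A B : Matrix n} → A ≈ᴹ B → B ≈ᴹ A
≈ᴹ-sym A≈B i j = sym (A≈B i j)

≈ᴹ-trans : ∀ {n} {A B C : Matrix n} → A ≈ᴹ B → B ≈ᴹ C → A ≈ᴹ C
≈ᴹ-trans A≈B B≈C i j = trans (A≈B i j) (B≈C i j)

≈ᴹ-by-row : ∀ {n} (k : Fin n) {M N : Matrix n} →
            (∀ j → M k j ≡ N k j) → (∀ i j → ¬ i ≡ k → M i j ≡ N i j) → M ≈ᴹ N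
≈ᴹ-by-row k on-k off-k i j with i ≟ k
... | yes refl = on-k j
... | no i≢k   = off-k i j i≢k

≈ᴹ-by-column : ∀ {n} (k : Fin n) {M N : Matrix n} →
               (∀ i → M i k ≡ N i k) → (∀ i j → ¬ j ≡ k → M i j ≡ N i j) → M ≈ᴹ N
≈ᴹ-by-column k on-k off-k i j with j ≟ k
... | yes refl = on-k i
... | no j≢k   = off-k i j j≢k

≈ᴹ-by-diagonal : ∀ {n} {M N : Matrix n} →
                 (∀ i → M i i ≡ N i i) → (∀ i j → ¬ i ≡ j → M i j ≡ N i j) → M ≈ᴹ N
≈ᴹ-by-diagonal diag off i j with i ≟ j
... | yes refl = diag i
... | no i≢j   = off i j i≢j

≈ᴹ-by-pivot : ∀ {n} (k : Fin n) {M N : Matrix n} →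
              (∀ i → M i k ≡ N i k) → (∀ j → ¬ j ≡ k → M k j ≡ N k j) →
              (∀ i j → ¬ i ≡ k → ¬ j ≡ k → M i j ≡ N i j) → M ≈ᴹ N
≈ᴹ-by-pivot k {M} {N} col-k row-k rest = ≈ᴹ-by-column k col-k off-col
  where
  off-col : ∀ i j → ¬ j ≡ k → M i j ≡ N i j
  off-col i j j≢k with i ≟ k
  ... | yes refl = row-k j j≢k
  ... | no i≢k   = rest i j i≢k j≢k

⊗-entry : ∀ {n} (A B : Matrix n) i j → (A ⊗ B) i j ≡ sum (λ l → A i l * B l j)
⊗-entry A B i j = sumFin≡sum (λ l → A i l * B l j)

⊗-cong : ∀ {n} {A A' B B' : Matrix n} → A ≈ᴹ A' → B ≈ᴹ B' → (A ⊗ B) ≈ᴹ (A' ⊗ B')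
⊗-cong {A = A} {A'} {B} {B'} A≈A' B≈B' i j = begin
  (A ⊗ B) i j                    ≡⟨ ⊗-entry A B i j ⟩
  sum (λ l → A i l * B l j)      ≡⟨ sum-cong-≗ (λ l → cong₂ _*_ (A≈A' i l) (B≈B' l j)) ⟩
  sum (λ l → A' i l * B' l j)    ≡⟨ sym (⊗-entry A' B' i j) ⟩
  (A' ⊗ B') i j                  ∎

⊗-assoc : ∀ {n} (A B C : Matrix n) → ((A ⊗ B) ⊗ C) ≈ᴹ (A ⊗ (B ⊗ C))
⊗-assoc A B C i j = begin
  ((A ⊗ B) ⊗ C) i j                                  ≡⟨ ⊗-entry (A ⊗ B) C i j ⟩
  sum (λ m → (A ⊗ B) i m * C m j)                    ≡⟨ sum-cong-≗ (λ m → cong (_* C m j) (⊗-entry A B i m)) ⟩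
  sum (λ m → sum (λ l → A i l * B l m) * C m j)      ≡⟨ sum-cong-≗ (λ m → *-distribʳ-sum (C m j) (λ l → A i l * B l m)) ⟩
  sum (λ m → sum (λ l → A i l * B l m * C m j))      ≡⟨ ∑-comm (λ m l → A i l * B l m * C m j) ⟩
  sum (λ l → sum (λ m → A i l * B l m * C m j))      ≡⟨ sum-cong-≗ (λ l → sum-cong-≗ (λ m → *-assoc (A i l) (B l m) (C m j))) ⟩
  sum (λ l → sum (λ m → A i l * (B l m * C m j)))    ≡⟨ sum-cong-≗ (λ l → sym (*-distribˡ-sum (A i l) (λ m → B l m * C m j))) ⟩
  sum (λ l → A i l * sum (λ m → B l m * C m j))      ≡⟨ sum-cong-≗ (λ l → cong (A i l *_) (sym (⊗-entry B C l j))) ⟩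
  sum (λ l → A i l * (B ⊗ C) l j)                    ≡⟨ sym (⊗-entry A (B ⊗ C) i j) ⟩
  (A ⊗ (B ⊗ C)) i j                                  ∎

⊗-distribˡ-⊕ : ∀ {n} (A X Y : Matrix n) → (A ⊗ (X ⊕ Y)) ≈ᴹ ((A ⊗ X) ⊕ (A ⊗ Y))
⊗-distribˡ-⊕ A X Y i j = begin
  (A ⊗ (X ⊕ Y)) i j                                    ≡⟨ ⊗-entry A (X ⊕ Y) i j ⟩
  sum (λ l → A i l * (X l j + Y l j))                  ≡⟨ sum-cong-≗ (λ l → *-distribˡ-+ (A i l) (X l j) (Y l j)) ⟩
  sum (λ l → A i l * X l j + A i l * Y l j)            ≡⟨ ∑-distrib-+ (λ l → A i l * X l j) (λ l → A i l * Y l j) ⟩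
  sum (λ l → A i l * X l j) + sum (λ l → A i l * Y l j) ≡⟨ sym (cong₂ _+_ (⊗-entry A X i j) (⊗-entry A Y i j)) ⟩
  (A ⊗ X) i j + (A ⊗ Y) i j                            ∎

⊗-distribʳ-⊕ : ∀ {n} (X Y A : Matrix n) → ((X ⊕ Y) ⊗ A) ≈ᴹ ((X ⊗ A) ⊕ (Y ⊗ A))
⊗-distribʳ-⊕ X Y A i j = begin
  ((X ⊕ Y) ⊗ A) i j                                    ≡⟨ ⊗-entry (X ⊕ Y) A i j ⟩
  sum (λ l → (X i l + Y i l) * A l j)                  ≡⟨ sum-cong-≗ (λ l → *-distribʳ-+ (A l j) (X i l) (Y i l)) ⟩
  sum (λ l → X i l * A l j + Y i l * A l j)            ≡⟨ ∑-distrib-+ (λ l → X i l * A l j) (λ l → Y i l * A l j) ⟩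
  sum (λ l → X i l * A l j) + sum (λ l → Y i l * A l j) ≡⟨ sym (cong₂ _+_ (⊗-entry X A i j) (⊗-entry Y A i j)) ⟩
  (X ⊗ A) i j + (Y ⊗ A) i j                            ∎

⊗-negᴹ : ∀ {n} (A X : Matrix n) → (A ⊗ negᴹ X) ≈ᴹ negᴹ (A ⊗ X)
⊗-negᴹ A X i j = begin
  (A ⊗ negᴹ X) i j              ≡⟨ ⊗-entry A (negᴹ X) i j ⟩
  sum (λ l → A i l * - X l j)   ≡⟨ sum-cong-≗ (λ l → sym (neg-distribʳ-* (A i l) (X l j))) ⟩
  sum (λ l → - (A i l * X l j)) ≡⟨ sum-neg (λ l → A i l * X l j) ⟩
  - sum (λ l → A i l * X l j)   ≡⟨ cong -_ (sym (⊗-entry A X i j)) ⟩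
  - (A ⊗ X) i j                 ∎

negᴹ-⊗ : ∀ {n} (X A : Matrix n) → (negᴹ X ⊗ A) ≈ᴹ negᴹ (X ⊗ A)
negᴹ-⊗ X A i j = begin
  (negᴹ X ⊗ A) i j              ≡⟨ ⊗-entry (negᴹ X) A i j ⟩
  sum (λ l → - X i l * A l j)   ≡⟨ sum-cong-≗ (λ l → sym (neg-distribˡ-* (X i l) (A l j))) ⟩
  sum (λ l → - (X i l * A l j)) ≡⟨ sum-neg (λ l → X i l * A l j) ⟩
  - sum (λ l → X i l * A l j)   ≡⟨ cong -_ (sym (⊗-entry X A i j)) ⟩
  - (X ⊗ A) i j                 ∎

⊗-distribʳ-⊖ : ∀ {n} (X Y A : Matrix n) → ((X ⊖ Y) ⊗ A) ≈ᴹ ((X ⊗ A) ⊖ (Y ⊗ A))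
⊗-distribʳ-⊖ X Y A i j =
  trans (⊗-distribʳ-⊕ X (negᴹ Y) A i j) (cong (λ x → (X ⊗ A) i j + x) (negᴹ-⊗ Y A i j))

J-pivot : ∀ {n} (k : Fin n) → J k k k ≡ -1ℤ
J-pivot k rewrite dec-true (k ≟ k) refl = refl

J-diag : ∀ {n} (k j : Fin n) → ¬ j ≡ k → J k j j ≡ 1ℤ
J-diag k j j≢k rewrite dec-true (j ≟ j) refl | dec-false (j ≟ k) j≢k = refl

J-offdiag : ∀ {n} (k i j : Fin n) → ¬ i ≡ j → J k i j ≡ 0ℤ
J-offdiag k i j i≢j rewrite dec-false (i ≟ j) i≢j = refl

Iᴹ-diag : ∀ {n} (j : Fin n) → Iᴹ j j ≡ 1ℤ
Iᴹ-diag j rewrite dec-true (j ≟ j) refl = refl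

Iᴹ-offdiag : ∀ {n} (i j : Fin n) → ¬ i ≡ j → Iᴹ i j ≡ 0ℤ
Iᴹ-offdiag i j i≢j rewrite dec-false (i ≟ j) i≢j = refl

rowOnly-row : ∀ {n} (k : Fin n) A j → rowOnly k A k j ≡ A k j
rowOnly-row k A j rewrite dec-true (k ≟ k) refl = refl

rowOnly-off : ∀ {n} (k : Fin n) A i j → ¬ i ≡ k → rowOnly k A i j ≡ 0ℤ
rowOnly-off k A i j i≢k rewrite dec-false (i ≟ k) i≢k = refl

colOnly-col : ∀ {n} (k : Fin n) A i → colOnly k A i k ≡ A i k
colOnly-col k A i rewrite dec-true (k ≟ k) refl = refl

colOnly-off : ∀ {n} (k : Fin n) A i j → ¬ j ≡ k → colOnly k A i j ≡ 0ℤ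
colOnly-off k A i j j≢k rewrite dec-false (j ≟ k) j≢k = refl

μ-row : ∀ {n} (k : Fin n) B j → μ k B k j ≡ - B k j
μ-row k B j rewrite dec-true (k ≟ k) refl = refl

μ-col : ∀ {n} (k : Fin n) B i → μ k B i k ≡ - B i k
μ-col k B i with i ≟ k
... | yes _ = refl
... | no _ rewrite dec-true (k ≟ k) refl = refl

μ-off : ∀ {n} (k : Fin n) B i j → ¬ i ≡ k → ¬ j ≡ k →
        μ k B i j ≡ B i j + sgn (B i k) * pos (B i k * B k j)
μ-off k B i j i≢k j≢k rewrite dec-false (i ≟ k) i≢k | dec-false (j ≟ k) j≢k = refl

⊗-sparseʳ : ∀ {n} (A Y : Matrix n) i j m → (∀ l → ¬ l ≡ m → Y l j ≡ 0ℤ) →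
            (A ⊗ Y) i j ≡ A i m * Y m j
⊗-sparseʳ A Y i j m Y≡0 = trans (⊗-entry A Y i j)
  (sum-δ (λ l → A i l * Y l j) m (λ l l≢m → trans (cong (A i l *_) (Y≡0 l l≢m)) (*-zeroʳ (A i l))))

⊗-sparseˡ : ∀ {n} (Y A : Matrix n) i j m → (∀ l → ¬ l ≡ m → Y i l ≡ 0ℤ) →
            (Y ⊗ A) i j ≡ Y i m * A m j
⊗-sparseˡ Y A i j m Y≡0 = trans (⊗-entry Y A i j)
  (sum-δ (λ l → Y i l * A l j) m (λ l l≢m → cong (_* A l j) (Y≡0 l l≢m)))

⊗-J : ∀ {n} (k : Fin n) (A : Matrix n) i j → (A ⊗ J k) i j ≡ A i j * J k j j
⊗-J k A i j = ⊗-sparseʳ A (J k) i j j (λ l → J-offdiag k l j)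

J-⊗ : ∀ {n} (k : Fin n) (A : Matrix n) i j → (J k ⊗ A) i j ≡ J k i i * A i j
J-⊗ k A i j = ⊗-sparseˡ (J k) A i j i (λ l l≢i → J-offdiag k i l (l≢i ∘ sym))

⊗-Iᴹ : ∀ {n} (A : Matrix n) → (A ⊗ Iᴹ) ≈ᴹ A
⊗-Iᴹ A i j = begin
  (A ⊗ Iᴹ) i j    ≡⟨ ⊗-sparseʳ A Iᴹ i j j (λ l → Iᴹ-offdiag l j) ⟩
  A i j * Iᴹ j j  ≡⟨ cong (A i j *_) (Iᴹ-diag j) ⟩
  A i j * 1ℤ      ≡⟨ *-identityʳ _ ⟩
  A i j           ∎

Iᴹ-⊗ : ∀ {n} (A : Matrix n) → (Iᴹ ⊗ A) ≈ᴹ A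
Iᴹ-⊗ A i j = begin
  (Iᴹ ⊗ A) i j    ≡⟨ ⊗-sparseˡ Iᴹ A i j i (λ l l≢i → Iᴹ-offdiag i l (l≢i ∘ sym)) ⟩
  Iᴹ i i * A i j  ≡⟨ cong (_* A i j) (Iᴹ-diag i) ⟩
  1ℤ * A i j      ≡⟨ *-identityˡ _ ⟩
  A i j           ∎

⊗-rowOnly : ∀ {n} (k : Fin n) (A X : Matrix n) i j → (A ⊗ rowOnly k X) i j ≡ A i k * X k j
⊗-rowOnly k A X i j =
  trans (⊗-sparseʳ A (rowOnly k X) i j k (λ l → rowOnly-off k X l j)) (cong (A i k *_) (rowOnly-row k X j))

colOnly-⊗ : ∀ {n} (k : Fin n) (Y A : Matrix n) i j → (colOnly k Y ⊗ A) i j ≡ Y i k * A k j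
colOnly-⊗ k Y A i j =
  trans (⊗-sparseˡ (colOnly k Y) A i j k (colOnly-off k Y i)) (cong (_* A k j) (colOnly-col k Y i))

⊗-colOnly : ∀ {n} (k : Fin n) (A Y : Matrix n) → (A ⊗ colOnly k Y) ≈ᴹ colOnly k (A ⊗ Y)
⊗-colOnly k A Y = ≈ᴹ-by-column k on-k off-k
  where
  on-k : ∀ i → (A ⊗ colOnly k Y) i k ≡ colOnly k (A ⊗ Y) i k
  on-k i = begin
    (A ⊗ colOnly k Y) i k               ≡⟨ ⊗-entry A (colOnly k Y) i k ⟩
    sum (λ l → A i l * colOnly k Y l k) ≡⟨ sum-cong-≗ (λ l → cong (A i l *_) (colOnly-col k Y l)) ⟩
    sum (λ l → A i l * Y l k)           ≡⟨ sym (⊗-entry A Y i k) ⟩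
    (A ⊗ Y) i k                         ≡⟨ sym (colOnly-col k (A ⊗ Y) i) ⟩
    colOnly k (A ⊗ Y) i k               ∎
  off-k : ∀ i j → ¬ j ≡ k → (A ⊗ colOnly k Y) i j ≡ colOnly k (A ⊗ Y) i j
  off-k i j j≢k = begin
    (A ⊗ colOnly k Y) i j               ≡⟨ ⊗-sparseʳ A (colOnly k Y) i j k (λ l _ → colOnly-off k Y l j j≢k) ⟩
    A i k * colOnly k Y k j             ≡⟨ cong (A i k *_) (colOnly-off k Y k j j≢k) ⟩
    A i k * 0ℤ                          ≡⟨ *-zeroʳ (A i k) ⟩
    0ℤ                                  ≡⟨ sym (colOnly-off k (A ⊗ Y) i j j≢k) ⟩
    colOnly k (A ⊗ Y) i j               ∎

rowOnly-cong : ∀ {n} (k : Fin n) {X X' : Matrix n} → (∀ j → X k j ≡ X' k j) → rowOnly k X ≈ᴹ rowOnly k X'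
rowOnly-cong k {X} {X'} X≡X' = ≈ᴹ-by-row k
  (λ j → trans (rowOnly-row k X j) (trans (X≡X' j) (sym (rowOnly-row k X' j))))
  (λ i j i≢k → trans (rowOnly-off k X i j i≢k) (sym (rowOnly-off k X' i j i≢k)))

colOnly-cong : ∀ {n} (k : Fin n) {Y Y' : Matrix n} → (∀ i → Y i k ≡ Y' i k) → colOnly k Y ≈ᴹ colOnly k Y'
colOnly-cong k {Y} {Y'} Y≡Y' = ≈ᴹ-by-column k
  (λ i → trans (colOnly-col k Y i) (trans (Y≡Y' i) (sym (colOnly-col k Y' i))))
  (λ i j j≢k → trans (colOnly-off k Y i j j≢k) (sym (colOnly-off k Y' i j j≢k)))

J-diag² : ∀ {n} (k j : Fin n) → J k j j * J k j j ≡ 1ℤ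
J-diag² k j = square (j ≟ k)
  where
  square : Dec (j ≡ k) → J k j j * J k j j ≡ 1ℤ
  square (yes j≡k) = subst (λ l → J k l l * J k l l ≡ 1ℤ) (sym j≡k) (cong (λ x → x * x) (J-pivot k))
  square (no j≢k)  = cong (λ x → x * x) (J-diag k j j≢k)

J-diag-* : ∀ {n} (k l : Fin n) {x} → (l ≡ k → x ≡ 0ℤ) → J k l l * x ≡ x
J-diag-* k l {x} x≡0 = scale (l ≟ k)
  where
  scale : Dec (l ≡ k) → J k l l * x ≡ x
  scale (yes l≡k) = trans (cong (J k l l *_) (x≡0 l≡k)) (trans (*-zeroʳ (J k l l)) (sym (x≡0 l≡k)))
  scale (no l≢k)  = trans (cong (_* x) (J-diag k l l≢k)) (*-identityˡ x)

J-involutive : ∀ {n} (k : Fin n) → (J k ⊗ J k) ≈ᴹ Iᴹ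
J-involutive k = ≈ᴹ-by-diagonal
  (λ i → trans (⊗-J k (J k) i i) (trans (J-diag² k i) (sym (Iᴹ-diag i))))
  (λ i j i≢j → begin
    (J k ⊗ J k) i j   ≡⟨ ⊗-J k (J k) i j ⟩
    J k i j * J k j j ≡⟨ cong (_* J k j j) (J-offdiag k i j i≢j) ⟩
    0ℤ                ≡⟨ sym (Iᴹ-offdiag i j i≢j) ⟩
    Iᴹ i j            ∎)

Jrow : ∀ {n} → Fin n → Matrix n → Matrix n
Jrow k X = J k ⊕ rowOnly k X

Jcol : ∀ {n} → Fin n → Matrix n → Matrix n
Jcol k Y = J k ⊕ colOnly k Y

Jrow-cong : ∀ {n} (k : Fin n) {X X' : Matrix n} → (∀ j → X k j ≡ X' k j) → Jrow k X ≈ᴹ Jrow k X'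
Jrow-cong k X≡X' i j = cong (λ x → J k i j + x) (rowOnly-cong k X≡X' i j)

Jcol-cong : ∀ {n} (k : Fin n) {Y Y' : Matrix n} → (∀ i → Y i k ≡ Y' i k) → Jcol k Y ≈ᴹ Jcol k Y'
Jcol-cong k Y≡Y' i j = cong (λ y → J k i j + y) (colOnly-cong k Y≡Y' i j)

⊗-Jrow : ∀ {n} (k : Fin n) (A X : Matrix n) i j → (A ⊗ Jrow k X) i j ≡ A i j * J k j j + A i k * X k j
⊗-Jrow k A X i j =
  trans (⊗-distribˡ-⊕ A (J k) (rowOnly k X) i j) (cong₂ _+_ (⊗-J k A i j) (⊗-rowOnly k A X i j))

⊗-Jcol : ∀ {n} (k : Fin n) (A Y : Matrix n) → (A ⊗ Jcol k Y) ≈ᴹ ((A ⊗ J k) ⊕ colOnly k (A ⊗ Y))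
⊗-Jcol k A Y i j =
  trans (⊗-distribˡ-⊕ A (J k) (colOnly k Y) i j) (cong (λ x → (A ⊗ J k) i j + x) (⊗-colOnly k A Y i j))

Jcol-⊗ : ∀ {n} (k : Fin n) (Y A : Matrix n) i j → (Jcol k Y ⊗ A) i j ≡ J k i i * A i j + Y i k * A k j
Jcol-⊗ k Y A i j =
  trans (⊗-distribʳ-⊕ (J k) (colOnly k Y) A i j) (cong₂ _+_ (J-⊗ k A i j) (colOnly-⊗ k Y A i j))

Jrow-involutive : ∀ {n} (k : Fin n) (X : Matrix n) → X k k ≡ 0ℤ → (Jrow k X ⊗ Jrow k X) ≈ᴹ Iᴹ
Jrow-involutive k X Xkk≡0 = ≈ᴹ-by-row k row-k off-k
  where
  M = Jrow k X
  Mkk≡-1 : M k k ≡ -1ℤ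
  Mkk≡-1 = cong₂ _+_ (J-pivot k) (trans (rowOnly-row k X k) Xkk≡0)
  expand : ∀ a x d → (a + x) * d + -1ℤ * x ≡ a * d + (d * x - x)
  expand = solve-∀
  row-k : ∀ j → (M ⊗ M) k j ≡ Iᴹ k j
  row-k j = begin
    (M ⊗ M) k j                                     ≡⟨ ⊗-Jrow k M X k j ⟩
    M k j * J k j j + M k k * X k j                 ≡⟨ cong₂ (λ a b → (J k k j + a) * J k j j + b * X k j)
                                                               (rowOnly-row k X j) Mkk≡-1 ⟩
    (J k k j + X k j) * J k j j + -1ℤ * X k j       ≡⟨ expand (J k k j) (X k j) (J k j j) ⟩
    J k k j * J k j j + (J k j j * X k j - X k j)   ≡⟨ cong (λ x → J k k j * J k j j + (x - X k j))
                                                            (J-diag-* k j (λ { refl → Xkk≡0 })) ⟩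
    J k k j * J k j j + (X k j - X k j)             ≡⟨ cong (λ x → J k k j * J k j j + x) (+-inverseʳ (X k j)) ⟩
    J k k j * J k j j + 0ℤ                          ≡⟨ +-identityʳ _ ⟩
    J k k j * J k j j                               ≡⟨ sym (⊗-J k (J k) k j) ⟩
    (J k ⊗ J k) k j                                 ≡⟨ J-involutive k k j ⟩
    Iᴹ k j                                          ∎
  off-k : ∀ i j → ¬ i ≡ k → (M ⊗ M) i j ≡ Iᴹ i j
  off-k i j i≢k = begin
    (M ⊗ M) i j                                         ≡⟨ ⊗-Jrow k M X i j ⟩
    (J k i j + rowOnly k X i j) * J k j j + M i k * X k j
                                                        ≡⟨ cong₂ (λ a b → (J k i j + a) * J k j j + b * X k j)
                                                                 (rowOnly-off k X i j i≢k)
                                                                 (cong₂ _+_ (J-offdiag k i k i≢k) (rowOnly-off k X i k i≢k)) ⟩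
    (J k i j + 0ℤ) * J k j j + 0ℤ * X k j               ≡⟨ simplify (J k i j) (J k j j) (X k j) ⟩
    J k i j * J k j j                                   ≡⟨ sym (⊗-J k (J k) i j) ⟩
    (J k ⊗ J k) i j                                     ≡⟨ J-involutive k i j ⟩
    Iᴹ i j                                              ∎
    where
    simplify : ∀ a d x → (a + 0ℤ) * d + 0ℤ * x ≡ a * d
    simplify = solve-∀

Jcol-involutive : ∀ {n} (k : Fin n) (Y : Matrix n) → Y k k ≡ 0ℤ → (Jcol k Y ⊗ Jcol k Y) ≈ᴹ Iᴹ
Jcol-involutive k Y Ykk≡0 = ≈ᴹ-by-column k col-k off-k
  where
  N = Jcol k Y
  Nkk≡-1 : N k k ≡ -1ℤ
  Nkk≡-1 = cong₂ _+_ (J-pivot k) (trans (colOnly-col k Y k) Ykk≡0)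
  expand : ∀ d a y → d * (a + y) + y * -1ℤ ≡ d * a + (d * y - y)
  expand = solve-∀
  col-k : ∀ i → (N ⊗ N) i k ≡ Iᴹ i k
  col-k i = begin
    (N ⊗ N) i k                                     ≡⟨ Jcol-⊗ k Y N i k ⟩
    J k i i * N i k + Y i k * N k k                 ≡⟨ cong₂ (λ a b → J k i i * (J k i k + a) + Y i k * b)
                                                             (colOnly-col k Y i) Nkk≡-1 ⟩
    J k i i * (J k i k + Y i k) + Y i k * -1ℤ       ≡⟨ expand (J k i i) (J k i k) (Y i k) ⟩
    J k i i * J k i k + (J k i i * Y i k - Y i k)   ≡⟨ cong (λ x → J k i i * J k i k + (x - Y i k))
                                                            (J-diag-* k i (λ { refl → Ykk≡0 })) ⟩
    J k i i * J k i k + (Y i k - Y i k)             ≡⟨ cong (λ x → J k i i * J k i k + x) (+-inverseʳ (Y i k)) ⟩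
    J k i i * J k i k + 0ℤ                          ≡⟨ +-identityʳ _ ⟩
    J k i i * J k i k                               ≡⟨ sym (J-⊗ k (J k) i k) ⟩
    (J k ⊗ J k) i k                                 ≡⟨ J-involutive k i k ⟩
    Iᴹ i k                                          ∎
  off-k : ∀ i j → ¬ j ≡ k → (N ⊗ N) i j ≡ Iᴹ i j
  off-k i j j≢k = begin
    (N ⊗ N) i j                                             ≡⟨ Jcol-⊗ k Y N i j ⟩
    J k i i * (J k i j + colOnly k Y i j) + Y i k * N k j   ≡⟨ cong₂ (λ a b → J k i i * (J k i j + a) + Y i k * b)
                                                                     (colOnly-off k Y i j j≢k)
                                                                     (cong₂ _+_ (J-offdiag k k j (j≢k ∘ sym))
                                                                                (colOnly-off k Y k j j≢k)) ⟩
    J k i i * (J k i j + 0ℤ) + Y i k * 0ℤ                   ≡⟨ simplify (J k i i) (J k i j) (Y i k) ⟩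
    J k i i * J k i j                                       ≡⟨ sym (J-⊗ k (J k) i j) ⟩
    (J k ⊗ J k) i j                                         ≡⟨ J-involutive k i j ⟩
    Iᴹ i j                                                  ∎
    where
    simplify : ∀ d a y → d * (a + 0ℤ) + y * 0ℤ ≡ d * a
    simplify = solve-∀

⊗-cancel-involution : ∀ {n} (A M : Matrix n) → (M ⊗ M) ≈ᴹ Iᴹ → ((A ⊗ M) ⊗ M) ≈ᴹ A
⊗-cancel-involution A M M²≈I =
  ≈ᴹ-trans (⊗-assoc A M M) (≈ᴹ-trans (⊗-cong (≈ᴹ-refl {A = A}) M²≈I) (⊗-Iᴹ A))

μ-intertwines : ∀ {n} (k : Fin n) (B : Matrix n) → B k k ≡ 0ℤ →
                (Jcol k (posᴹ (negᴹ B)) ⊗ μ k B) ≈ᴹ (B ⊗ Jrow k (posᴹ B))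
μ-intertwines k B Bkk≡0 = ≈ᴹ-by-pivot k
  (λ i → expand i (col-k i))
  (λ j j≢k → expand k (row-k j j≢k))
  (λ i j i≢k j≢k → expand i (rest i j i≢k j≢k))
  where
  expand : ∀ i {j} → J k i i * μ k B i j + pos (- B i k) * μ k B k j ≡ B i j * J k j j + B i k * pos (B k j) →
           (Jcol k (posᴹ (negᴹ B)) ⊗ μ k B) i j ≡ (B ⊗ Jrow k (posᴹ B)) i j
  expand i {j} e = trans (Jcol-⊗ k (posᴹ (negᴹ B)) (μ k B) i j) (trans e (sym (⊗-Jrow k B (posᴹ B) i j)))
  col-k : ∀ i → J k i i * μ k B i k + pos (- B i k) * μ k B k k ≡ B i k * J k k k + B i k * pos (B k k)
  col-k i rewrite μ-col k B i | μ-col k B k | J-pivot k | Bkk≡0 =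
    trans (cong₂ _+_ (J-diag-* k i (λ { refl → cong -_ Bkk≡0 })) (*-zeroʳ (pos (- B i k)))) (simplify (B i k))
    where
    simplify : ∀ b → - b + 0ℤ ≡ b * -1ℤ + b * 0ℤ
    simplify = solve-∀
  row-k : ∀ j → ¬ j ≡ k → J k k k * μ k B k j + pos (- B k k) * μ k B k j ≡ B k j * J k j j + B k k * pos (B k j)
  row-k j j≢k rewrite μ-row k B j | J-pivot k | J-diag k j j≢k | Bkk≡0 = simplify (B k j) (pos (B k j))
    where
    simplify : ∀ b b₊ → -1ℤ * - b + 0ℤ * - b ≡ b * 1ℤ + 0ℤ * b₊
    simplify = solve-∀
  rest : ∀ i j → ¬ i ≡ k → ¬ j ≡ k →
         J k i i * μ k B i j + pos (- B i k) * μ k B k j ≡ B i j * J k j j + B i k * pos (B k j)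
  rest i j i≢k j≢k rewrite μ-off k B i j i≢k j≢k | μ-row k B j | J-diag k i i≢k | J-diag k j j≢k
                         | sgn*pos-* (B i k) (B k j) = simplify (B i j) (B i k) (B k j) (pos (B k j)) (pos (- B i k))
    where
    simplify : ∀ b a c c₊ a₋ → 1ℤ * (b + (a * c₊ + a₋ * c)) + a₋ * - c ≡ b * 1ℤ + a * c₊
    simplify = solve-∀

stepC : ∀ {n} → Matrix n → Fin n → Matrix n → Matrix n
stepC Bt k C = (C ⊗ Jrow k (posᴹ Bt)) ⊕ (colOnly k (posᴹ (negᴹ C)) ⊗ Bt)

stepG : ∀ {n} → Matrix n → Matrix n → Fin n → Matrix n → Matrix n → Matrix n
stepG B₀ Bt k C G = (G ⊗ Jcol k (posᴹ (negᴹ Bt))) ⊖ (B₀ ⊗ colOnly k (posᴹ (negᴹ C)))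

colOnly-⊗-μ : ∀ {n} (k : Fin n) (P B : Matrix n) → (colOnly k P ⊗ μ k B) ≈ᴹ negᴹ (colOnly k P ⊗ B)
colOnly-⊗-μ k P B i j = begin
  (colOnly k P ⊗ μ k B) i j  ≡⟨ colOnly-⊗ k P (μ k B) i j ⟩
  P i k * μ k B k j          ≡⟨ cong (P i k *_) (μ-row k B j) ⟩
  P i k * - B k j            ≡⟨ sym (neg-distribʳ-* (P i k) (B k j)) ⟩
  - (P i k * B k j)          ≡⟨ cong -_ (sym (colOnly-⊗ k P B i j)) ⟩
  - (colOnly k P ⊗ B) i j    ∎

step-preserves-duality : ∀ {n} (B₀ Bt B' C G : Matrix n) (k : Fin n) → Bt k k ≡ 0ℤ → B' ≈ᴹ μ k Bt →
                         (G ⊗ Bt) ≈ᴹ (B₀ ⊗ C) → (stepG B₀ Bt k C G ⊗ B') ≈ᴹ (B₀ ⊗ stepC Bt k C)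
step-preserves-duality B₀ Bt B' C G k Bkk≡0 B'≈μB GB≈B₀C i j = begin
  (stepG B₀ Bt k C G ⊗ B') i j                          ≡⟨ ⊗-distribʳ-⊖ (G ⊗ N) (B₀ ⊗ Q) B' i j ⟩
  ((G ⊗ N) ⊗ B') i j - ((B₀ ⊗ Q) ⊗ B') i j             ≡⟨ cong₂ _-_ (via-intertwining i j) (via-row-k i j) ⟩
  (B₀ ⊗ (C ⊗ M)) i j - - (B₀ ⊗ (Q ⊗ Bt)) i j           ≡⟨ cong ((B₀ ⊗ (C ⊗ M)) i j +_) (neg-involutive _) ⟩
  (B₀ ⊗ (C ⊗ M)) i j + (B₀ ⊗ (Q ⊗ Bt)) i j             ≡⟨ sym (⊗-distribˡ-⊕ B₀ (C ⊗ M) (Q ⊗ Bt) i j) ⟩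
  (B₀ ⊗ stepC Bt k C) i j                              ∎
  where
  N = Jcol k (posᴹ (negᴹ Bt))
  M = Jrow k (posᴹ Bt)
  Q = colOnly k (posᴹ (negᴹ C))
  via-intertwining : ((G ⊗ N) ⊗ B') ≈ᴹ (B₀ ⊗ (C ⊗ M))
  via-intertwining i j = begin
    ((G ⊗ N) ⊗ B') i j  ≡⟨ ⊗-assoc G N B' i j ⟩
    (G ⊗ (N ⊗ B')) i j  ≡⟨ ⊗-cong (≈ᴹ-refl {A = G}) (≈ᴹ-trans (⊗-cong (≈ᴹ-refl {A = N}) B'≈μB)
                                                               (μ-intertwines k Bt Bkk≡0)) i j ⟩
    (G ⊗ (Bt ⊗ M)) i j  ≡⟨ sym (⊗-assoc G Bt M i j) ⟩
    ((G ⊗ Bt) ⊗ M) i j  ≡⟨ ⊗-cong GB≈B₀C (≈ᴹ-refl {A = M}) i j ⟩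
    ((B₀ ⊗ C) ⊗ M) i j  ≡⟨ ⊗-assoc B₀ C M i j ⟩
    (B₀ ⊗ (C ⊗ M)) i j  ∎
  via-row-k : ((B₀ ⊗ Q) ⊗ B') ≈ᴹ negᴹ (B₀ ⊗ (Q ⊗ Bt))
  via-row-k i j = begin
    ((B₀ ⊗ Q) ⊗ B') i j          ≡⟨ ⊗-assoc B₀ Q B' i j ⟩
    (B₀ ⊗ (Q ⊗ B')) i j          ≡⟨ ⊗-cong (≈ᴹ-refl {A = B₀}) (≈ᴹ-trans (⊗-cong (≈ᴹ-refl {A = Q}) B'≈μB)
                                                                         (colOnly-⊗-μ k _ Bt)) i j ⟩
    (B₀ ⊗ negᴹ (Q ⊗ Bt)) i j     ≡⟨ ⊗-negᴹ B₀ (Q ⊗ Bt) i j ⟩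
    - (B₀ ⊗ (Q ⊗ Bt)) i j        ∎

SignCoherentColumn : ∀ {n} → Matrix n → Fin n → ℤ → Set
SignCoherentColumn C k ε = (ε ≡ 1ℤ × (∀ i → 0ℤ ≤ C i k)) ⊎ (ε ≡ -1ℤ × (∀ i → C i k ≤ 0ℤ))

isColumnSign⇒signCoherent : ∀ {n} (C : Matrix n) k ε → IsColumnSign C k ε → SignCoherentColumn C k ε
isColumnSign⇒signCoherent C k ε (inj₁ refl , _ , 0≤εC) =
  inj₁ (refl , λ i → subst (0ℤ ≤_) (*-identityˡ (C i k)) (0≤εC i))
isColumnSign⇒signCoherent C k ε (inj₂ refl , _ , 0≤εC) =
  inj₂ (refl , λ i → subst (_≤ 0ℤ) (neg-involutive (C i k)) (neg-mono-≤ (subst (0ℤ ≤_) (-1*i≡-i (C i k)) (0≤εC i))))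

signCoherent-neg : ∀ {n} (C C' : Matrix n) k ε → (∀ i → C i k ≡ - C' i k) →
                   SignCoherentColumn C k ε → SignCoherentColumn C' k (- ε)
signCoherent-neg C C' k ε C≡-C' (inj₁ (refl , 0≤C)) =
  inj₂ (refl , λ i → subst (_≤ 0ℤ) (neg-involutive (C' i k)) (neg-mono-≤ (subst (0ℤ ≤_) (C≡-C' i) (0≤C i))))
signCoherent-neg C C' k ε C≡-C' (inj₂ (refl , C≤0)) =
  inj₁ (refl , λ i → subst (0ℤ ≤_) (neg-involutive (C' i k)) (neg-mono-≤ (subst (_≤ 0ℤ) (C≡-C' i) (C≤0 i))))

signCoherent-*-pos : ∀ {n} (C : Matrix n) k ε → SignCoherentColumn C k ε →
                    ∀ i b → C i k * pos b + pos (- C i k) * b ≡ C i k * pos (ε * b)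
signCoherent-*-pos C k ε (inj₁ (refl , 0≤C)) i b = begin
  c * pos b + pos (- c) * b  ≡⟨ cong (λ x → c * pos b + x * b) (pos-nonpos (neg-mono-≤ (0≤C i))) ⟩
  c * pos b + 0ℤ             ≡⟨ +-identityʳ _ ⟩
  c * pos b                  ≡⟨ cong (λ x → c * pos x) (sym (*-identityˡ b)) ⟩
  c * pos (1ℤ * b)           ∎
  where c = C i k
signCoherent-*-pos C k ε (inj₂ (refl , C≤0)) i b = begin
  c * pos b + pos (- c) * b  ≡⟨ cong (λ x → c * pos b + x * b) (pos-nonneg (neg-mono-≤ (C≤0 i))) ⟩
  c * pos b + - c * b        ≡⟨ cong (λ x → c * x + - c * b) (pos≡pos-neg+ b) ⟩
  c * (pos (- b) + b) + - c * b ≡⟨ cancel c (pos (- b)) b ⟩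
  c * pos (- b)              ≡⟨ cong (λ x → c * pos x) (sym (-1*i≡-i b)) ⟩
  c * pos (-1ℤ * b)          ∎
  where
  c = C i k
  cancel : ∀ c x b → c * (x + b) + - c * b ≡ c * x
  cancel = solve-∀

stepC-signCoherent : ∀ {n} (Bt C : Matrix n) k ε → SignCoherentColumn C k ε →
                     stepC Bt k C ≈ᴹ (C ⊗ Jrow k (posᴹ (scaleᴹ ε Bt)))
stepC-signCoherent Bt C k ε coherent i j = begin
  stepC Bt k C i j                                           ≡⟨ cong₂ _+_ (⊗-Jrow k C (posᴹ Bt) i j)
                                                                          (colOnly-⊗ k (posᴹ (negᴹ C)) Bt i j) ⟩
  C i j * J k j j + C i k * pos (Bt k j) + pos (- C i k) * Bt k j
                                                             ≡⟨ +-assoc (C i j * J k j j) _ _ ⟩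
  C i j * J k j j + (C i k * pos (Bt k j) + pos (- C i k) * Bt k j)
                                                             ≡⟨ cong (λ x → C i j * J k j j + x)
                                                                     (signCoherent-*-pos C k ε coherent i (Bt k j)) ⟩
  C i j * J k j j + C i k * pos (ε * Bt k j)                 ≡⟨ sym (⊗-Jrow k C (posᴹ (scaleᴹ ε Bt)) i j) ⟩
  (C ⊗ Jrow k (posᴹ (scaleᴹ ε Bt))) i j                      ∎

stepC-column-k : ∀ {n} (Bt C : Matrix n) k → Bt k k ≡ 0ℤ → ∀ i → stepC Bt k C i k ≡ - C i k
stepC-column-k Bt C k Bkk≡0 i = begin
  stepC Bt k C i k                                          ≡⟨ cong₂ _+_ (⊗-Jrow k C (posᴹ Bt) i k)
                                                                         (colOnly-⊗ k (posᴹ (negᴹ C)) Bt i k) ⟩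
  C i k * J k k k + C i k * pos (Bt k k) + pos (- C i k) * Bt k k
                                                            ≡⟨ cong₂ (λ a b → C i k * a + C i k * pos b + pos (- C i k) * b)
                                                                     (J-pivot k) Bkk≡0 ⟩
  C i k * -1ℤ + C i k * 0ℤ + pos (- C i k) * 0ℤ             ≡⟨ simplify (C i k) (pos (- C i k)) ⟩
  - C i k                                                   ∎
  where
  simplify : ∀ c p → c * -1ℤ + c * 0ℤ + p * 0ℤ ≡ - c
  simplify = solve-∀

⊗-column-cong : ∀ {n} (A Y Y' : Matrix n) k → (∀ l → Y l k ≡ Y' l k) →
                ∀ i → (A ⊗ Y) i k ≡ (A ⊗ Y') i k
⊗-column-cong A Y Y' k Y≡Y' i = begin
  (A ⊗ Y) i k                ≡⟨ ⊗-entry A Y i k ⟩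
  sum (λ l → A i l * Y l k)  ≡⟨ sum-cong-≗ (λ l → cong (A i l *_) (Y≡Y' l)) ⟩
  sum (λ l → A i l * Y' l k) ≡⟨ sym (⊗-entry A Y' i k) ⟩
  (A ⊗ Y') i k               ∎

⊗-zero-column : ∀ {n} (A Y : Matrix n) k → (∀ l → Y l k ≡ 0ℤ) → ∀ i → (A ⊗ Y) i k ≡ 0ℤ
⊗-zero-column {n} A Y k Y≡0 i = begin
  (A ⊗ Y) i k                ≡⟨ ⊗-entry A Y i k ⟩
  sum (λ l → A i l * Y l k)  ≡⟨ sum-cong-≗ (λ l → trans (cong (A i l *_) (Y≡0 l)) (*-zeroʳ (A i l))) ⟩
  sum {n} (λ _ → 0ℤ)         ≡⟨ sum-replicate-zero n ⟩
  0ℤ                         ∎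

stepG-column-k : ∀ {n} (B₀ Bt C G : Matrix n) k ε → SignCoherentColumn C k ε → (G ⊗ Bt) ≈ᴹ (B₀ ⊗ C) →
                 ∀ i → (G ⊗ posᴹ (negᴹ Bt)) i k - (B₀ ⊗ posᴹ (negᴹ C)) i k
                       ≡ (G ⊗ posᴹ (negᴹ (scaleᴹ ε Bt))) i k
stepG-column-k B₀ Bt C G k ε (inj₁ (refl , 0≤C)) GB≈B₀C i = begin
  (G ⊗ Y) i k - (B₀ ⊗ Q) i k          ≡⟨ cong (λ x → (G ⊗ Y) i k - x) (⊗-zero-column B₀ Q k Q≡0 i) ⟩
  (G ⊗ Y) i k - 0ℤ                    ≡⟨ +-identityʳ _ ⟩
  (G ⊗ Y) i k                         ≡⟨ ⊗-column-cong G Y Y' k Y≡Y' i ⟩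
  (G ⊗ Y') i k                        ∎
  where
  Y  = posᴹ (negᴹ Bt)
  Y' = posᴹ (negᴹ (scaleᴹ 1ℤ Bt))
  Q  = posᴹ (negᴹ C)
  Y≡Y' : ∀ l → Y l k ≡ Y' l k
  Y≡Y' l = cong (λ x → pos (- x)) (sym (*-identityˡ (Bt l k)))
  Q≡0 : ∀ l → Q l k ≡ 0ℤ
  Q≡0 l = pos-nonpos (neg-mono-≤ (0≤C l))
stepG-column-k B₀ Bt C G k ε (inj₂ (refl , C≤0)) GB≈B₀C i = begin
  (G ⊗ Y) i k - (B₀ ⊗ Q) i k          ≡⟨ cong (λ x → (G ⊗ Y) i k - x) (⊗-column-cong B₀ Q (negᴹ C) k Q≡-C i) ⟩
  (G ⊗ Y) i k - (B₀ ⊗ negᴹ C) i k     ≡⟨ cong (λ x → (G ⊗ Y) i k - x) (⊗-negᴹ B₀ C i k) ⟩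
  (G ⊗ Y) i k - - (B₀ ⊗ C) i k        ≡⟨ cong (λ x → (G ⊗ Y) i k + x) (neg-involutive _) ⟩
  (G ⊗ Y) i k + (B₀ ⊗ C) i k          ≡⟨ cong (λ x → (G ⊗ Y) i k + x) (sym (GB≈B₀C i k)) ⟩
  (G ⊗ Y) i k + (G ⊗ Bt) i k          ≡⟨ sym (⊗-distribˡ-⊕ G Y Bt i k) ⟩
  (G ⊗ (Y ⊕ Bt)) i k                  ≡⟨ ⊗-column-cong G (Y ⊕ Bt) Y' k (λ l → pos-neg+≡pos-neg-neg (Bt l k)) i ⟩
  (G ⊗ Y') i k                        ∎
  where
  Y  = posᴹ (negᴹ Bt)
  Y' = posᴹ (negᴹ (scaleᴹ -1ℤ Bt))
  Q  = posᴹ (negᴹ C)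
  Q≡-C : ∀ l → Q l k ≡ - C l k
  Q≡-C l = pos-nonneg (neg-mono-≤ (C≤0 l))
  pos-neg+≡pos-neg-neg : ∀ b → pos (- b) + b ≡ pos (- (-1ℤ * b))
  pos-neg+≡pos-neg-neg b = begin
    pos (- b) + b       ≡⟨ sym (pos≡pos-neg+ b) ⟩
    pos b               ≡⟨ cong pos (sym (neg-involutive b)) ⟩
    pos (- - b)         ≡⟨ cong (λ x → pos (- x)) (sym (-1*i≡-i b)) ⟩
    pos (- (-1ℤ * b))   ∎

stepG-signCoherent : ∀ {n} (B₀ Bt C G : Matrix n) k ε → SignCoherentColumn C k ε → (G ⊗ Bt) ≈ᴹ (B₀ ⊗ C) →
                     stepG B₀ Bt k C G ≈ᴹ (G ⊗ Jcol k (posᴹ (negᴹ (scaleᴹ ε Bt))))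
stepG-signCoherent B₀ Bt C G k ε coherent GB≈B₀C = ≈ᴹ-by-column k col-k off-k
  where
  Y  = posᴹ (negᴹ Bt)
  Y' = posᴹ (negᴹ (scaleᴹ ε Bt))
  Q  = posᴹ (negᴹ C)
  expand : ∀ i j → stepG B₀ Bt k C G i j ≡ (G ⊗ J k) i j + colOnly k (G ⊗ Y) i j - colOnly k (B₀ ⊗ Q) i j
  expand i j = cong₂ _-_ (⊗-Jcol k G Y i j) (⊗-colOnly k B₀ Q i j)
  col-k : ∀ i → stepG B₀ Bt k C G i k ≡ (G ⊗ Jcol k Y') i k
  col-k i = begin
    stepG B₀ Bt k C G i k                                           ≡⟨ expand i k ⟩
    (G ⊗ J k) i k + colOnly k (G ⊗ Y) i k - colOnly k (B₀ ⊗ Q) i k  ≡⟨ cong₂ (λ a b → (G ⊗ J k) i k + a - b)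
                                                                              (colOnly-col k (G ⊗ Y) i)
                                                                              (colOnly-col k (B₀ ⊗ Q) i) ⟩
    (G ⊗ J k) i k + (G ⊗ Y) i k - (B₀ ⊗ Q) i k                      ≡⟨ +-assoc ((G ⊗ J k) i k) _ _ ⟩
    (G ⊗ J k) i k + ((G ⊗ Y) i k - (B₀ ⊗ Q) i k)                    ≡⟨ cong (λ x → (G ⊗ J k) i k + x)
                                                                            (stepG-column-k B₀ Bt C G k ε coherent GB≈B₀C i) ⟩
    (G ⊗ J k) i k + (G ⊗ Y') i k                                    ≡⟨ cong (λ x → (G ⊗ J k) i k + x)
                                                                            (sym (colOnly-col k (G ⊗ Y') i)) ⟩
    (G ⊗ J k) i k + colOnly k (G ⊗ Y') i k                          ≡⟨ sym (⊗-Jcol k G Y' i k) ⟩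
    (G ⊗ Jcol k Y') i k                                             ∎
  off-k : ∀ i j → ¬ j ≡ k → stepG B₀ Bt k C G i j ≡ (G ⊗ Jcol k Y') i j
  off-k i j j≢k = begin
    stepG B₀ Bt k C G i j                                           ≡⟨ expand i j ⟩
    (G ⊗ J k) i j + colOnly k (G ⊗ Y) i j - colOnly k (B₀ ⊗ Q) i j  ≡⟨ cong₂ (λ a b → (G ⊗ J k) i j + a - b)
                                                                              (colOnly-off k (G ⊗ Y) i j j≢k)
                                                                              (colOnly-off k (B₀ ⊗ Q) i j j≢k) ⟩
    (G ⊗ J k) i j + 0ℤ - 0ℤ                                         ≡⟨ +-identityʳ _ ⟩
    (G ⊗ J k) i j + 0ℤ                                              ≡⟨ cong (λ x → (G ⊗ J k) i j + x)
                                                                            (sym (colOnly-off k (G ⊗ Y') i j j≢k)) ⟩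
    (G ⊗ J k) i j + colOnly k (G ⊗ Y') i j                          ≡⟨ sym (⊗-Jcol k G Y' i j) ⟩
    (G ⊗ Jcol k Y') i j                                             ∎

vertex-≡ : ∀ {n} {v v' : Vertex n} → proj₁ v ≡ proj₁ v' → v ≡ v'
vertex-≡ {v = w , _} {.w , _} refl = cong (w ,_) (T-irrelevant _ _)

step-pop : ∀ {n} (k : Fin n) w r → proj₁ (step k (k ∷ w , r)) ≡ w
step-pop k w r with k ≟ k
... | yes _   = refl
... | no k≢k = ⊥-elim (k≢k refl)

step-push : ∀ {n} (k j : Fin n) w r → ¬ k ≡ j → proj₁ (step k (j ∷ w , r)) ≡ k ∷ j ∷ w
step-push k j w r k≢j with k ≟ j
... | yes k≡j = ⊥-elim (k≢j k≡j)
... | no _    = refl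

reduced-head : ∀ {n} (k i : Fin n) w → T (reducedᵇ (k ∷ i ∷ w)) → ¬ k ≡ i
reduced-head k i w r k≡i with k ≟ i
reduced-head k i w () k≡i | yes _
... | no k≢i = k≢i k≡i

step-push-or-pop : ∀ {n} (k : Fin n) t → (proj₁ (step k t) ≡ k ∷ proj₁ t) ⊎ (proj₁ t ≡ k ∷ proj₁ (step k t))
step-push-or-pop k ([] , _) = inj₁ refl
step-push-or-pop k (j ∷ w , _) with k ≟ j
... | yes refl = inj₂ refl
... | no _     = inj₁ refl

step-involutive : ∀ {n} (k : Fin n) t → step k (step k t) ≡ t
step-involutive k ([] , r) = vertex-≡ (step-pop k [] _)
step-involutive k (j ∷ w , r) with k ≟ j
step-involutive k (.k ∷ [] , r)     | yes refl = refl
step-involutive k (.k ∷ i ∷ w , r)  | yes refl = vertex-≡ (step-push k i w _ (reduced-head k i w r))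
step-involutive k (j ∷ w , r)       | no _     = vertex-≡ (step-pop k (j ∷ w) _)

joinBranches : ∀ {n} → List (Fin n) × List (Fin n) → List (Fin n)
joinBranches (a , b) = reverse a ++ b

dropCommon-[] : ∀ {n} (xs : List (Fin n)) → dropCommon xs [] ≡ (xs , [])
dropCommon-[] []      = refl
dropCommon-[] (_ ∷ _) = refl

joinBranches-∷ʳ : ∀ {n} (x y : List (Fin n)) k →
                  (joinBranches (dropCommon x (y ∷ʳ k)) ≡ joinBranches (dropCommon x y) ∷ʳ k)
                  ⊎ (joinBranches (dropCommon x y) ≡ joinBranches (dropCommon x (y ∷ʳ k)) ∷ʳ k)
joinBranches-∷ʳ []       y        k = inj₁ refl
joinBranches-∷ʳ (x ∷ xs) []       k with x ≟ k
... | yes refl rewrite dropCommon-[] xs = inj₂ (begin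
  reverse (x ∷ xs) ++ []    ≡⟨ ++-identityʳ _ ⟩
  reverse (x ∷ xs)          ≡⟨ unfold-reverse x xs ⟩
  reverse xs ∷ʳ x           ≡⟨ cong (_∷ʳ x) (sym (++-identityʳ _)) ⟩
  (reverse xs ++ []) ∷ʳ x   ∎)
... | no _     = inj₁ (cong (_∷ʳ k) (sym (++-identityʳ _)))
joinBranches-∷ʳ (x ∷ xs) (y ∷ ys) k with x ≟ y
... | yes _ = joinBranches-∷ʳ xs ys k
... | no _  = inj₁ (sym (++-assoc (reverse (x ∷ xs)) (y ∷ ys) (k ∷ [])))

AwayFrom : ∀ {n} → Vertex n → Fin n → Vertex n → Vertex n → Set
AwayFrom t₀ k t t' = pathLabels t₀ t' ≡ pathLabels t₀ t ∷ʳ k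

pathLabels-push : ∀ {n} (t₀ t t' : Vertex n) k → proj₁ t' ≡ k ∷ proj₁ t →
                  AwayFrom t₀ k t t' ⊎ AwayFrom t₀ k t' t
pathLabels-push (u , _) (w , _) (.(k ∷ w) , _) k refl =
  subst (λ w' → (joinBranches (dropCommon (reverse u) w') ≡ joinBranches (dropCommon (reverse u) (reverse w)) ∷ʳ k)
                ⊎ (joinBranches (dropCommon (reverse u) (reverse w)) ≡ joinBranches (dropCommon (reverse u) w') ∷ʳ k))
        (sym (unfold-reverse k w))
        (joinBranches-∷ʳ (reverse u) (reverse w) k)

edge-orientation : ∀ {n} (t₀ t : Vertex n) k → AwayFrom t₀ k t (step k t) ⊎ AwayFrom t₀ k (step k t) t
edge-orientation t₀ t k with step-push-or-pop k t
... | inj₁ push = pathLabels-push t₀ t (step k t) k push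
... | inj₂ pop  = swap (pathLabels-push t₀ (step k t) t k pop)

follow : ∀ {n} → Vertex n → List (Fin n) → Vertex n
follow v []       = v
follow v (k ∷ ks) = follow (step k v) ks

follow-∷ʳ : ∀ {n} (v : Vertex n) ks k → follow v (ks ∷ʳ k) ≡ step k (follow v ks)
follow-∷ʳ v []       k = refl
follow-∷ʳ v (j ∷ ks) k = follow-∷ʳ (step j v) ks k

reduced-tail : ∀ {n} (k : Fin n) w → T (reducedᵇ (k ∷ w)) → T (reducedᵇ w)
reduced-tail k []      _ = _
reduced-tail k (j ∷ w) r = proj₂ (Equivalence.to T-∧ r)

step-pop-vertex : ∀ {n} (k : Fin n) w r → step k (k ∷ w , r) ≡ (w , reduced-tail k w r)
step-pop-vertex k w r = vertex-≡ (step-pop k w r)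

follow-own-word : ∀ {n} (u : List (Fin n)) r → proj₁ (follow (u , r) u) ≡ []
follow-own-word []      r = refl
follow-own-word (x ∷ u) r = trans (cong (λ v → proj₁ (follow v u)) (step-pop-vertex x u r)) (follow-own-word u _)

follow-pathLabels-step : ∀ {n} (t₀ s : Vertex n) j → follow t₀ (pathLabels t₀ s) ≡ s →
                         follow t₀ (pathLabels t₀ (step j s)) ≡ step j s
follow-pathLabels-step t₀ s j reaches-s with edge-orientation t₀ s j
... | inj₁ away = begin
  follow t₀ (pathLabels t₀ (step j s))   ≡⟨ cong (follow t₀) away ⟩
  follow t₀ (pathLabels t₀ s ∷ʳ j)       ≡⟨ follow-∷ʳ t₀ (pathLabels t₀ s) j ⟩
  step j (follow t₀ (pathLabels t₀ s))   ≡⟨ cong (step j) reaches-s ⟩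
  step j s                               ∎
... | inj₂ toward = begin
  follow t₀ (pathLabels t₀ (step j s))                    ≡⟨ sym (step-involutive j _) ⟩
  step j (step j (follow t₀ (pathLabels t₀ (step j s))))  ≡⟨ cong (step j) (sym (follow-∷ʳ t₀ (pathLabels t₀ (step j s)) j)) ⟩
  step j (follow t₀ (pathLabels t₀ (step j s) ∷ʳ j))      ≡⟨ cong (step j ∘ follow t₀) (sym toward) ⟩
  step j (follow t₀ (pathLabels t₀ s))                    ≡⟨ cong (step j) reaches-s ⟩
  step j s                                                ∎

follow-pathLabels : ∀ {n} (t₀ t : Vertex n) → follow t₀ (pathLabels t₀ t) ≡ t
follow-pathLabels {n} (u , r₀) (w , r) = reaches w r
  where
  t₀ : Vertex n
  t₀ = (u , r₀)
  reaches : ∀ w r → follow t₀ (pathLabels t₀ (w , r)) ≡ (w , r)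
  reaches [] r = vertex-≡ (begin
    proj₁ (follow t₀ (joinBranches (dropCommon (reverse u) [])))  ≡⟨ cong (λ p → proj₁ (follow t₀ (joinBranches p)))
                                                                            (dropCommon-[] (reverse u)) ⟩
    proj₁ (follow t₀ (reverse (reverse u) ++ []))                 ≡⟨ cong (λ p → proj₁ (follow t₀ p))
                                                                            (trans (++-identityʳ _) (reverse-involutive u)) ⟩
    proj₁ (follow t₀ u)                                           ≡⟨ follow-own-word u r₀ ⟩
    []                                                            ∎)
  reaches (j ∷ w) r = begin
    follow t₀ (pathLabels t₀ (j ∷ w , r))           ≡⟨ cong (follow t₀ ∘ pathLabels t₀) (sym back) ⟩
    follow t₀ (pathLabels t₀ (step j (w , r')))     ≡⟨ follow-pathLabels-step t₀ (w , r') j (reaches w r') ⟩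
    step j (w , r')                                 ≡⟨ back ⟩
    (j ∷ w , r)                                     ∎
    where
    r' : T (reducedᵇ w)
    r' = reduced-tail j w r
    back : step j (w , r') ≡ (j ∷ w , r)
    back = trans (cong (step j) (sym (step-pop-vertex j w r))) (step-involutive j (j ∷ w , r))

square-nonpos⇒zero : ∀ x → x * x ≤ 0ℤ → x ≡ 0ℤ
square-nonpos⇒zero +0       _        = refl
square-nonpos⇒zero +[1+ _ ] (+≤+ ())
square-nonpos⇒zero -[1+ _ ] (+≤+ ())

signSkewSymmetric⇒diagonal-zero : ∀ {n} (B : Matrix n) → SignSkewSymmetric B → ∀ k → B k k ≡ 0ℤ
signSkewSymmetric⇒diagonal-zero B ssB k = square-nonpos⇒zero (B k k) (proj₁ (ssB k k))

pattern-diagonal-zero : ∀ {n} (B : Vertex n → Matrix n) → IsExchangeMatrixPattern B → ∀ t k → B t k k ≡ 0ℤ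
pattern-diagonal-zero B pat t = signSkewSymmetric⇒diagonal-zero (B t) (proj₁ pat t [])

CGalong-∷ʳ : ∀ {n} (B : Vertex n → Matrix n) B₀ v ks k cg →
             CGalong B B₀ v (ks ∷ʳ k) cg ≡ CGstep B₀ (B (follow v ks)) k (CGalong B B₀ v ks cg)
CGalong-∷ʳ B B₀ v []       k cg = refl
CGalong-∷ʳ B B₀ v (j ∷ ks) k cg = CGalong-∷ʳ B B₀ (step j v) ks k (CGstep B₀ (B v) j cg)

duality-along : ∀ {n} (B : Vertex n → Matrix n) → IsExchangeMatrixPattern B → ∀ B₀ ks v C G →
                (G ⊗ B v) ≈ᴹ (B₀ ⊗ C) →
                (proj₂ (CGalong B B₀ v ks (C , G)) ⊗ B (follow v ks)) ≈ᴹ (B₀ ⊗ proj₁ (CGalong B B₀ v ks (C , G)))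
duality-along B pat B₀ []       v C G GB≈B₀C = GB≈B₀C
duality-along B pat B₀ (k ∷ ks) v C G GB≈B₀C =
  duality-along B pat B₀ ks (step k v) (stepC (B v) k C) (stepG B₀ (B v) k C G)
    (step-preserves-duality B₀ (B v) (B (step k v)) C G k (pattern-diagonal-zero B pat v k)
                            (proj₂ pat k v (step k v) refl) GB≈B₀C)

duality : ∀ {n} (B : Vertex n → Matrix n) → IsExchangeMatrixPattern B → ∀ t₀ t →
          (Gmat B t₀ t ⊗ B t) ≈ᴹ (B t₀ ⊗ Cmat B t₀ t)
duality B pat t₀ t =
  subst (λ v → (Gmat B t₀ t ⊗ B v) ≈ᴹ (B t₀ ⊗ Cmat B t₀ t)) (follow-pathLabels t₀ t)
        (duality-along B pat (B t₀) (pathLabels t₀ t) t₀ Iᴹ Iᴹ (≈ᴹ-trans (Iᴹ-⊗ (B t₀)) (≈ᴹ-sym (⊗-Iᴹ (B t₀)))))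

CG-away : ∀ {n} (B : Vertex n → Matrix n) t₀ t t' k → AwayFrom t₀ k t t' →
          CG B t₀ t' ≡ CGstep (B t₀) (B t) k (CG B t₀ t)
CG-away B t₀ t t' k away = begin
  CG B t₀ t'                                                          ≡⟨ cong (λ p → CGalong B (B t₀) t₀ p (Iᴹ , Iᴹ)) away ⟩
  CGalong B (B t₀) t₀ (pathLabels t₀ t ∷ʳ k) (Iᴹ , Iᴹ)                ≡⟨ CGalong-∷ʳ B (B t₀) t₀ (pathLabels t₀ t) k (Iᴹ , Iᴹ) ⟩
  CGstep (B t₀) (B (follow t₀ (pathLabels t₀ t))) k (CG B t₀ t)       ≡⟨ cong (λ v → CGstep (B t₀) (B v) k (CG B t₀ t))
                                                                              (follow-pathLabels t₀ t) ⟩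
  CGstep (B t₀) (B t) k (CG B t₀ t)                                   ∎

flip-involution : ∀ {n} {A A' M : Matrix n} → (M ⊗ M) ≈ᴹ Iᴹ → A ≈ᴹ (A' ⊗ M) → A' ≈ᴹ (A ⊗ M)
flip-involution {A = A} {A'} {M} M²≈I A≈A'M =
  ≈ᴹ-trans (≈ᴹ-sym (⊗-cancel-involution A' M M²≈I)) (⊗-cong (≈ᴹ-sym A≈A'M) (≈ᴹ-refl {A = M}))

MutationFormulas : ∀ {n} → (Vertex n → Matrix n) → Vertex n → Vertex n → Vertex n → Fin n → ℤ → Set
MutationFormulas B t₀ t t' k ε =
  (Cmat B t₀ t' ≈ᴹ (Cmat B t₀ t ⊗ Jrow k (posᴹ (scaleᴹ ε (B t)))))
  × (Gmat B t₀ t' ≈ᴹ (Gmat B t₀ t ⊗ Jcol k (posᴹ (negᴹ (scaleᴹ ε (B t))))))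

formulas-away : ∀ {n} (B : Vertex n → Matrix n) → IsExchangeMatrixPattern B → ∀ t₀ t t' k ε →
                AwayFrom t₀ k t t' → SignCoherentColumn (Cmat B t₀ t) k ε → MutationFormulas B t₀ t t' k ε
formulas-away B pat t₀ t t' k ε away coherent = C-formula , G-formula
  where
  C = Cmat B t₀ t
  G = Gmat B t₀ t
  CG≡ : CG B t₀ t' ≡ CGstep (B t₀) (B t) k (CG B t₀ t)
  CG≡ = CG-away B t₀ t t' k away
  C-formula : Cmat B t₀ t' ≈ᴹ (C ⊗ Jrow k (posᴹ (scaleᴹ ε (B t))))
  C-formula i j = trans (cong (λ cg → proj₁ cg i j) CG≡) (stepC-signCoherent (B t) C k ε coherent i j)
  G-formula : Gmat B t₀ t' ≈ᴹ (G ⊗ Jcol k (posᴹ (negᴹ (scaleᴹ ε (B t)))))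
  G-formula i j = trans (cong (λ cg → proj₂ cg i j) CG≡)
                        (stepG-signCoherent (B t₀) (B t) C G k ε coherent (duality B pat t₀ t) i j)

Jrow-μ : ∀ {n} (k : Fin n) ε (B B' : Matrix n) → B ≈ᴹ μ k B' →
         Jrow k (posᴹ (scaleᴹ (- ε) B')) ≈ᴹ Jrow k (posᴹ (scaleᴹ ε B))
Jrow-μ k ε B B' B≈μB' = Jrow-cong k λ j → cong pos (begin
  - ε * B' k j    ≡⟨ -a*b≡a*-b ε (B' k j) ⟩
  ε * - B' k j    ≡⟨ cong (ε *_) (sym (trans (B≈μB' k j) (μ-row k B' j))) ⟩
  ε * B k j       ∎)

Jcol-μ : ∀ {n} (k : Fin n) ε (B B' : Matrix n) → B ≈ᴹ μ k B' →
         Jcol k (posᴹ (negᴹ (scaleᴹ (- ε) B'))) ≈ᴹ Jcol k (posᴹ (negᴹ (scaleᴹ ε B)))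
Jcol-μ k ε B B' B≈μB' = Jcol-cong k λ i → cong (λ b → pos (- b)) (begin
  - ε * B' i k    ≡⟨ -a*b≡a*-b ε (B' i k) ⟩
  ε * - B' i k    ≡⟨ cong (ε *_) (sym (trans (B≈μB' i k) (μ-col k B' i))) ⟩
  ε * B i k       ∎)

MutationFormulas-flip : ∀ {n} (B : Vertex n → Matrix n) t₀ t t' k ε → B t ≈ᴹ μ k (B t') → B t k k ≡ 0ℤ →
                        MutationFormulas B t₀ t' t k (- ε) → MutationFormulas B t₀ t t' k ε
MutationFormulas-flip B t₀ t t' k ε B≈μB' Bkk≡0 (C≈ , G≈) =
  flip-involution (Jrow-involutive k _ Xkk≡0)
                  (≈ᴹ-trans C≈ (⊗-cong (≈ᴹ-refl {A = Cmat B t₀ t'}) (Jrow-μ k ε (B t) (B t') B≈μB'))) ,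
  flip-involution (Jcol-involutive k _ Ykk≡0)
                  (≈ᴹ-trans G≈ (⊗-cong (≈ᴹ-refl {A = Gmat B t₀ t'}) (Jcol-μ k ε (B t) (B t') B≈μB')))
  where
  Xkk≡0 : pos (ε * B t k k) ≡ 0ℤ
  Xkk≡0 = cong pos (trans (cong (ε *_) Bkk≡0) (*-zeroʳ ε))
  Ykk≡0 : pos (- (ε * B t k k)) ≡ 0ℤ
  Ykk≡0 = cong (λ b → pos (- b)) (trans (cong (ε *_) Bkk≡0) (*-zeroʳ ε))

formulas-toward : ∀ {n} (B : Vertex n → Matrix n) → IsExchangeMatrixPattern B → ∀ t₀ t t' k ε → Edge k t t' →
                  AwayFrom t₀ k t' t → SignCoherentColumn (Cmat B t₀ t) k ε → MutationFormulas B t₀ t t' k ε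
formulas-toward B pat t₀ t t' k ε refl away coherent =
  MutationFormulas-flip B t₀ t t' k ε (proj₂ pat k t' t (sym (step-involutive k t))) (pattern-diagonal-zero B pat t k)
    (formulas-away B pat t₀ t' t k (- ε) away coherent')
  where
  column-k-flips : ∀ i → Cmat B t₀ t i k ≡ - Cmat B t₀ t' i k
  column-k-flips i = trans (cong (λ cg → proj₁ cg i k) (CG-away B t₀ t' t k away))
                           (stepC-column-k (B t') (Cmat B t₀ t') k (pattern-diagonal-zero B pat t' k) i)
  coherent' : SignCoherentColumn (Cmat B t₀ t') k (- ε)
  coherent' = signCoherent-neg (Cmat B t₀ t) (Cmat B t₀ t') k ε column-k-flips coherent

proposition4p5 : ∀ {n} (B : Vertex n → Matrix n) → IsExchangeMatrixPattern B →
    (t₀ t t' : Vertex n) (k : Fin n) → Edge k t t' →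
    (ε : ℤ) → IsColumnSign (Cmat B t₀ t) k ε →
    (Cmat B t₀ t' ≈ᴹ (Cmat B t₀ t ⊗ (J k ⊕ rowOnly k (posᴹ (scaleᴹ ε (B t))))))
    × (Gmat B t₀ t' ≈ᴹ (Gmat B t₀ t ⊗ (J k ⊕ colOnly k (posᴹ (negᴹ (scaleᴹ ε (B t)))))))
proposition4p5 B pat t₀ t .(step k t) k refl ε colSign = formulas (edge-orientation t₀ t k)
  where
  coherent : SignCoherentColumn (Cmat B t₀ t) k ε
  coherent = isColumnSign⇒signCoherent (Cmat B t₀ t) k ε colSign
  formulas : AwayFrom t₀ k t (step k t) ⊎ AwayFrom t₀ k (step k t) t → MutationFormulas B t₀ t (step k t) k ε
  formulas (inj₁ away)   = formulas-away B pat t₀ t (step k t) k ε away coherent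
  formulas (inj₂ toward) = formulas-toward B pat t₀ t (step k t) k ε refl toward coherent
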